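{- Let $k\ge1$ and let $\mathbf{H}$ be a $k$-hyperproperty (i.e., there exists a relation $R\subseteq \mathit{Tr}_\infty^k$ such that for every set $S\subseteq\mathit{Tr}_\infty$: $S\in\mathbf{H}$ iff every $\vec t\in\mathit{Tr}_\infty^k$ with $\{t_1,\dots,t_k\}\subseteq S$ satisfies $\vec t\in R$; such $R$ is said to define $\mathbf{H}$). Then $\mathbf{H}$ is definable (in this sense) by some $k$-safety relation if and only if $\mathbf{H}$ is a $k$-safety hyperproperty.
   Context: A trace is a finite or infinite sequence of states (over a fixed set of states); $\mathit{Tr}_{\mathrm{fin}}$ and $\mathit{Tr}_\infty$ denote the sets of finite and infinite traces. A hyperproperty is a set of sets of infinite traces. For a finite trace $t$ and a trace $t'$, $t\le t'$ ($t$ is a prefix of $t'$) iff $t'=tt''$ for some trace $t''$. For a finite set $T$ of finite traces and a set $T'$ of traces, $T\le T'$ iff every $t\in T$ has some $t'\in T'$ with $t\le t'$. A hyperproperty $\mathbf{S}$ is a $k$-safety hyperproperty iff for every $T\subseteq\mathit{Tr}_\infty$ with $T\notin\mathbf{S}$ there exists a finite $B\subseteq\mathit{Tr}_{\mathrm{fin}}$ with $|B|\le k$ and $B\le T$ such that every $U\subseteq\mathit{Tr}_\infty$ with $B\le U$ satisfies $U\notin\mathbf{S}$. A relation $R\subseteq\mathit{Tr}_\infty^k$ is a $k$-safety relation iff for every $\vec t\in\mathit{Tr}_\infty^k$ with $\vec t\notin R$ there exists a tuple $\vec b=(b_1,\dots,b_m)$ of finite traces with $m\le k$ and $b_i\le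 t_i$ for all $i\le m$, such that every $\vec u\in\mathit{Tr}_\infty^k$ with $b_i\le u_i$ for all $i\le m$ satisfies $\vec u\notin R$. -}

module Defs where

open import Data.Nat using (ℕ; zero; suc; _≤_)
open import Data.Fin using (Fin; inject≤)
open import Data.List using (List; []; _∷_; length)
open import Data.List.Membership.Propositional using (_∈_)
open import Data.Product using (Σ; ∃; _×_; _,_)
open import Relation.Binary.PropositionalEquality using (_≡_)
open import Relation.Nullary using (¬_)
open import Function.Bundles using (_⇔_)

module _ (State : Set) where

  TrFin : Set
  TrFin = List State

  TrInf : Set
  TrInf = ℕ → State

  TraceSet : Set₁
  TraceSet = TrInf → Set

  HyperProperty : Set₁
  HyperProperty = TraceSet → Set

  _++ᵢ_ : TrFin → TrInf → TrInf
  ([] ++ᵢ s) n = s n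
  ((x ∷ xs) ++ᵢ s) zero = x
  ((x ∷ xs) ++ᵢ s) (suc n) = (xs ++ᵢ s) n

  Prefix : TrFin → TrInf → Set
  Prefix t t' = ∃ λ (t'' : TrInf) → ∀ n → t' n ≡ (t ++ᵢ t'') n

  SetPrefix : List TrFin → TraceSet → Set
  SetPrefix B T = ∀ b → b ∈ B → ∃ λ t' → T t' × Prefix b t'

  IsKSafetyHyperproperty : ℕ → HyperProperty → Set₁
  IsKSafetyHyperproperty k H =
    (T : TraceSet) → ¬ H T →
    Σ (List TrFin) λ B → length B ≤ k × SetPrefix B T ×
      ((U : TraceSet) → SetPrefix B U → ¬ H U)

  Tuple : ℕ → Set
  Tuple k = Fin k → TrInf

  Relation : ℕ → Set₁
  Relation k = Tuple k → Set

  IsKSafetyRelation : (k : ℕ) → Relation k → Set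
  IsKSafetyRelation k R =
    (t : Tuple k) → ¬ R t →
    Σ ℕ λ m → Σ (m ≤ k) λ m≤k → Σ (Fin m → TrFin) λ b →
      (∀ i → Prefix (b i) (t (inject≤ i m≤k))) ×
      ((u : Tuple k) → (∀ i → Prefix (b i) (u (inject≤ i m≤k))) → ¬ R u)

  Defines : (k : ℕ) → Relation k → HyperProperty → Set₁
  Defines k R H = (S : TraceSet) → H S ⇔ ((t : Tuple k) → (∀ i → S (t i)) → R t)

  IsKHyperproperty : ℕ → HyperProperty → Set₁
  IsKHyperproperty k H = Σ (Relation k) λ R → Defines k R H

-- (⇒) If T ∉ H, excluded middle yields a k-tuple from T outside R. Its bad
-- prefix tuple, padded with empty traces to width k, is a set B ≤ T of at most k
-- finite traces, and any U with B ≤ U contains a tuple extending it, hence a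
-- tuple outside R, so U ∉ H.
-- (⇐) Let R t hold iff H contains the range {t₁, …, tₖ}; since R₀ defines H,
-- membership in H is decided on k-element subsets, so R defines H. If t ∉ R,
-- the bad set B for the range of t is witnessed by prefixes of the tᵢ, and
-- cutting every tᵢ at the maximal length in B gives a bad prefix tuple for t.
module Submission where

open import Defs
open import Data.Nat using (ℕ; zero; suc; _≥_; _≤_; _<_; s≤s; _⊔_; _<?_)
open import Data.Nat.Properties using (≤-refl; ≤-reflexive; ≤-trans; m≤m⊔n; m≤n⊔m)
open import Data.Fin using (Fin; inject≤; toℕ; fromℕ<)
open import Data.Fin.Properties using (inject≤-refl; toℕ-inject≤; toℕ-fromℕ<; toℕ<n; toℕ-injective)
open import Data.List using (List; []; _∷_; length; tabulate)
open import Data.List.Properties using (length-tabulate)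
open import Data.List.Membership.Propositional using (_∈_)
open import Data.List.Membership.Propositional.Properties using (∈-tabulate⁺; ∈-tabulate⁻)
open import Data.List.Relation.Unary.Any using (here; there)
open import Data.Product using (Σ; ∃; _×_; _,_; proj₁; proj₂)
open import Relation.Binary.PropositionalEquality using (_≡_; refl; sym; trans; subst; cong)
open import Relation.Nullary using (¬_; yes; no; contradiction)
open import Relation.Nullary.Decidable using (decidable-stable)
open import Function.Bundles using (_⇔_; mk⇔; Equivalence)
open import Axiom.ExcludedMiddle using (ExcludedMiddle)
open import Level using (0ℓ)

open Equivalence

module _ {State : Set} where

  []-prefix : ∀ s → Prefix State [] s
  []-prefix s = s , λ _ → refl

  ∷-prefix : ∀ {x xs s} → s 0 ≡ x → Prefix State xs (λ n → s (suc n)) → Prefix State (x ∷ xs) s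
  ∷-prefix s₀≡x (s' , s≡xs++s') = s' , λ { zero → s₀≡x ; (suc n) → s≡xs++s' n }

  ∷-prefix⁻ : ∀ {x xs s} → Prefix State (x ∷ xs) s → s 0 ≡ x × Prefix State xs (λ n → s (suc n))
  ∷-prefix⁻ (s' , s≡x∷xs++s') = s≡x∷xs++s' 0 , s' , λ n → s≡x∷xs++s' (suc n)

  take : ℕ → TrInf State → TrFin State
  take zero    s = []
  take (suc n) s = s 0 ∷ take n (λ m → s (suc m))

  take-prefix : ∀ n s → Prefix State (take n s) s
  take-prefix zero    s = []-prefix s
  take-prefix (suc n) s = ∷-prefix refl (take-prefix n (λ m → s (suc m)))

  Prefix-trans-take : ∀ p {s u} n → Prefix State p s → length p ≤ n →
                      Prefix State (take n s) u → Prefix State p u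
  Prefix-trans-take []      {u = u} n       _   _           _     = []-prefix u
  Prefix-trans-take (x ∷ p) (suc n) p≤s (s≤s |p|≤n) s↾n≤u
    with ∷-prefix⁻ p≤s | ∷-prefix⁻ s↾n≤u
  ... | s₀≡x , p≤s' | u₀≡s₀ , s'↾n≤u' = ∷-prefix (trans u₀≡s₀ s₀≡x) (Prefix-trans-take p n p≤s' |p|≤n s'↾n≤u')

  maxLength : List (TrFin State) → ℕ
  maxLength []      = 0
  maxLength (b ∷ B) = length b ⊔ maxLength B

  length≤maxLength : ∀ {b B} → b ∈ B → length b ≤ maxLength B
  length≤maxLength (here refl) = m≤m⊔n _ _
  length≤maxLength (there b∈B) = ≤-trans (length≤maxLength b∈B) (m≤n⊔m _ _)

  range : ∀ {k} → Tuple State k → TraceSet State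
  range t x = ∃ λ i → x ≡ t i

  Prefixes : ∀ {k} → (Fin k → TrFin State) → Tuple State k → Set
  Prefixes b t = ∀ i → Prefix State (b i) (t i)

  BadPrefixTuples : (k : ℕ) → Relation State k → Set
  BadPrefixTuples k R =
    (t : Tuple State k) → ¬ R t →
    Σ (Fin k → TrFin State) λ b → Prefixes b t × ((u : Tuple State k) → Prefixes b u → ¬ R u)

  pad : ∀ {m k} → m ≤ k → (Fin m → TrFin State) → Fin k → TrFin State
  pad {m} m≤k b j with toℕ j <? m
  ... | yes j<m = b (fromℕ< j<m)
  ... | no  _   = []

  pad-inject≤ : ∀ {m k} (m≤k : m ≤ k) b i → pad m≤k b (inject≤ i m≤k) ≡ b i
  pad-inject≤ {m} m≤k b i with toℕ (inject≤ i m≤k) <? m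
  ... | yes i<m = cong b (toℕ-injective (trans (toℕ-fromℕ< i<m) (toℕ-inject≤ i m≤k)))
  ... | no  i≮m = contradiction (subst (_< m) (sym (toℕ-inject≤ i m≤k)) (toℕ<n i)) i≮m

  pad-prefixes : ∀ {m k} (m≤k : m ≤ k) b t →
                 (∀ i → Prefix State (b i) (t (inject≤ i m≤k))) → Prefixes (pad m≤k b) t
  pad-prefixes {m} m≤k b t b≤t j with toℕ j <? m
  ... | yes j<m = subst (λ i → Prefix State (b (fromℕ< j<m)) (t i))
                    (toℕ-injective (trans (toℕ-inject≤ _ m≤k) (toℕ-fromℕ< j<m))) (b≤t (fromℕ< j<m))
  ... | no  _   = []-prefix (t j)

  safety-relation⇒bad-prefixes : ∀ {k R} → IsKSafetyRelation State k R → BadPrefixTuples k R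
  safety-relation⇒bad-prefixes safe t ¬Rt with safe t ¬Rt
  ... | m , m≤k , b , b≤t , bad = pad m≤k b , pad-prefixes m≤k b t b≤t , λ u b′≤u →
    bad u λ i → subst (λ p → Prefix State p (u (inject≤ i m≤k))) (pad-inject≤ m≤k b i) (b′≤u _)

  bad-prefixes⇒safety-relation : ∀ {k R} → BadPrefixTuples k R → IsKSafetyRelation State k R
  bad-prefixes⇒safety-relation {k} bad t ¬Rt with bad t ¬Rt
  ... | b , b≤t , b-bad = k , ≤-refl , b ,
    (λ i → subst (λ j → Prefix State (b i) (t j)) (sym (inject≤-refl i ≤-refl)) (b≤t i)) ,
    λ u b≤u → b-bad u λ i → subst (λ j → Prefix State (b i) (u j)) (inject≤-refl i ≤-refl) (b≤u i)

  SetPrefix-tabulate⁺ : ∀ {k T} {b : Fin k → TrFin State} {t} →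
                        Prefixes b t → (∀ i → T (t i)) → SetPrefix State (tabulate b) T
  SetPrefix-tabulate⁺ {t = t} b≤t t∈T β β∈B with ∈-tabulate⁻ β∈B
  ... | i , refl = t i , t∈T i , b≤t i

  SetPrefix-tabulate⁻ : ∀ {k U} {b : Fin k → TrFin State} →
                        SetPrefix State (tabulate b) U → ∃ λ u → (∀ i → U (u i)) × Prefixes b u
  SetPrefix-tabulate⁻ {U = U} {b} B≤U =
    (λ i → proj₁ (witness i)) , (λ i → proj₁ (proj₂ (witness i))) , (λ i → proj₂ (proj₂ (witness i)))
    where
    witness : ∀ i → ∃ λ u → U u × Prefix State (b i) u
    witness i = B≤U (b i) (∈-tabulate⁺ i)

  violating-tuple : ExcludedMiddle 0ℓ → ∀ {k R H T} → Defines State k R H → ¬ H T →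
                    ∃ λ t → (∀ i → T (t i)) × ¬ R t
  violating-tuple lem {T = T} defines ¬HT = decidable-stable lem λ none →
    ¬HT (from (defines T) λ t t∈T → decidable-stable lem λ ¬Rt → none (t , t∈T , ¬Rt))

  safety-relation⇒hyperproperty : ExcludedMiddle 0ℓ → ∀ {k R H} → Defines State k R H →
                                  IsKSafetyRelation State k R → IsKSafetyHyperproperty State k H
  safety-relation⇒hyperproperty lem defines safe T ¬HT with violating-tuple lem defines ¬HT
  ... | t , t∈T , ¬Rt with safety-relation⇒bad-prefixes safe t ¬Rt
  ... | b , b≤t , bad = tabulate b , ≤-reflexive (length-tabulate b) , SetPrefix-tabulate⁺ b≤t t∈T ,
    λ U B≤U HU → let u , u∈U , b≤u = SetPrefix-tabulate⁻ B≤U in bad u b≤u (to (defines U) HU u u∈U)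

  Defines-range : ∀ {k R H} → Defines State k R H → Defines State k (λ t → H (range t)) H
  Defines-range {H = H} defines S = mk⇔
    (λ HS t t∈S → from (defines (range t)) λ t′ t′∈t → to (defines S) HS t′ λ i →
       let j , t′ᵢ≡tⱼ = t′∈t i in subst S (sym t′ᵢ≡tⱼ) (t∈S j))
    (λ H-ranges → from (defines S) λ t t∈S →
       to (defines (range t)) (H-ranges t t∈S) t λ i → i , refl)

  range-bad-prefixes : ∀ {k H} → IsKSafetyHyperproperty State k H →
                       BadPrefixTuples k (λ t → H (range t))
  range-bad-prefixes {k} safe t ¬H-t with safe (range t) ¬H-t
  ... | B , _ , B≤t , B-bad = t↾n , (λ i → take-prefix n (t i)) ,
                              λ u t↾n≤u → B-bad (range u) (B≤range u t↾n≤u)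
    where
    n : ℕ
    n = maxLength B
    t↾n : Fin k → TrFin State
    t↾n i = take n (t i)
    B≤range : ∀ u → Prefixes t↾n u → SetPrefix State B (range u)
    B≤range u t↾n≤u β β∈B with B≤t β β∈B
    ... | _ , (j , refl) , β≤tⱼ =
      u j , (j , refl) , Prefix-trans-take β n β≤tⱼ (length≤maxLength β∈B) (t↾n≤u j)

proposition2 : ExcludedMiddle 0ℓ → (State : Set) → (k : ℕ) → k ≥ 1 →
    (H : HyperProperty State) → IsKHyperproperty State k H →
    (Σ (Relation State k) (λ R → IsKSafetyRelation State k R × Defines State k R H))
    ⇔ IsKSafetyHyperproperty State k H
proposition2 lem State k _ H (R₀ , defines₀) = mk⇔
  (λ (R , safe , defines) → safety-relation⇒hyperproperty lem defines safe)
  (λ safe → (λ t → H (range t)) ,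
            bad-prefixes⇒safety-relation (range-bad-prefixes safe) ,
            Defines-range defines₀)
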